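{- Let $s\ge 2$ and $n_1,\ldots,n_s\ge 1$ be integers, $n=n_1+\cdots+n_s$, and let $K_{n_1,\ldots,n_s}$ be the complete $s$-partite graph with partition sets $X_1,\ldots,X_s$, $|X_i|=n_i$. Let $F$ be a spanning forest of $K_{n_1,\ldots,n_s}$ with components $T_1,\ldots,T_c$, and put $n_{ip}=|X_i\cap V(T_p)|$, $m_p=|V(T_p)|$, $\alpha_p=nm_p-\sum_{i=1}^s n_in_{ip}$. Let $Z(0)$ be the $s\times s$ matrix with $(i,j)$ entry $\delta_{ij}-\sum_{p=1}^c\frac{n_{jp}(m_p-n_{ip})}{\alpha_p}$, let $\mathbf{b}=(n_1,\ldots,n_s)^{\top}$ and let $\mathbf{e}$ be the all-ones vector in $\mathbb{R}^s$. Then $\mathbf{b}^{\top}Z(0)=0$ and $Z(0)(n\mathbf{e}-\mathbf{b})=0$.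
   Context: $\delta_{ij}$ is the Kronecker delta. -}

module Defs where

open import Data.Nat as ℕ using (ℕ; zero; suc)
open import Data.Fin using (Fin; zero; suc; inject₁; fromℕ)
open import Data.Fin.Properties using () renaming (_≟_ to _≟ᶠ_)
open import Data.Product using (Σ; _×_; _,_; proj₁; proj₂)
open import Data.Rational using (ℚ; 0ℚ; 1ℚ; _+_; _*_; _-_; _÷_; ≢-nonZero; _/_)
open import Data.Integer using (+_)
open import Data.Rational.Properties using () renaming (_≟_ to _≟ℚ_)
open import Relation.Nullary using (¬_; yes; no)
open import Relation.Binary.PropositionalEquality using (_≡_; _≢_)
open import Relation.Binary.Construct.Closure.ReflexiveTransitive using (Star)
open import Function.Definitions using (Injective)
open import Function.Definitions using (Surjective)

ℕ→ℚ : ℕ → ℚ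
ℕ→ℚ m = (+ m) / 1

sumℕ : (m : ℕ) → (Fin m → ℕ) → ℕ
sumℕ zero    f = 0
sumℕ (suc m) f = f zero ℕ.+ sumℕ m (λ k → f (suc k))

sumℚ : (m : ℕ) → (Fin m → ℚ) → ℚ
sumℚ zero    f = 0ℚ
sumℚ (suc m) f = f zero + sumℚ m (λ k → f (suc k))

-- Total division on ℚ (x / 0 := 0); only ever applied to α_p > 0.
_/'_ : ℚ → ℚ → ℚ
x /' y with y ≟ℚ 0ℚ
... | yes _  = 0ℚ
... | no y≢0 = _÷_ x y {{≢-nonZero y≢0}}

δ : ∀ {s} → Fin s → Fin s → ℚ
δ i j with i ≟ᶠ j
... | yes _ = 1ℚ
... | no _  = 0ℚ

-- Vertex set of K_{n_1,...,n_s}: vertex (i , k) is the k-th vertex of part X_i.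
Vtx : (s : ℕ) → (Fin s → ℕ) → Set
Vtx s n = Σ (Fin s) (λ i → Fin (n i))

-- A cycle in a graph with adjacency Adj: at least 3 distinct vertices
-- v_0, ..., v_{k+2}, consecutive ones adjacent, and v_{k+2} adjacent to v_0.
IsCycle : {V : Set} → (V → V → Set) → (k : ℕ) → (Fin (3 ℕ.+ k) → V) → Set
IsCycle Adj k f =
  Injective _≡_ _≡_ f
  × (∀ (i : Fin (2 ℕ.+ k)) → Adj (f (inject₁ i)) (f (suc i)))
  × Adj (f (fromℕ (2 ℕ.+ k))) (f zero)

record SpanningForestOfK (s : ℕ) (n : Fin s → ℕ) : Set₁ where
  field
    Adj     : Vtx s n → Vtx s n → Set
    symm    : ∀ {u v} → Adj u v → Adj v u
    inK     : ∀ {u v} → Adj u v → proj₁ u ≢ proj₁ v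
    acyclic : ∀ k (f : Fin (3 ℕ.+ k) → Vtx s n) → ¬ IsCycle Adj k f

-- Components T_1..T_c of F given by a labelling comp : V → Fin c that is
-- surjective (every T_p nonempty) and with comp u ≡ comp v iff u, v are
-- joined by a path in F.
record Components {s : ℕ} {n : Fin s → ℕ} (F : SpanningForestOfK s n)
                  (c : ℕ) (comp : Vtx s n → Fin c) : Set where
  open SpanningForestOfK F
  field
    surj    : Surjective _≡_ _≡_ comp
    sound   : ∀ u v → comp u ≡ comp v → Star Adj u v
    complete : ∀ u v → Star Adj u v → comp u ≡ comp v

ntot : {s : ℕ} → (Fin s → ℕ) → ℕ
ntot {s} n = sumℕ s n

module _ {s : ℕ} (n : Fin s → ℕ) {c : ℕ} (comp : Vtx s n → Fin c) where

  nip : Fin s → Fin c → ℕ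
  nip i p = sumℕ (n i) (λ k → indicator (comp (i , k)))
    where
    indicator : Fin c → ℕ
    indicator q with q ≟ᶠ p
    ... | yes _ = 1
    ... | no _  = 0

  mp : Fin c → ℕ
  mp p = sumℕ s (λ i → nip i p)

  α : Fin c → ℚ
  α p = (ℕ→ℚ (ntot n) * ℕ→ℚ (mp p)) - sumℚ s (λ i → ℕ→ℚ (n i) * ℕ→ℚ (nip i p))

  Z0 : Fin s → Fin s → ℚ
  Z0 i j = δ i j - sumℚ c (λ p →
    (ℕ→ℚ (nip j p) * (ℕ→ℚ (mp p) - ℕ→ℚ (nip i p))) /' α p)

{-# OPTIONS --safe #-}
module Submission where

-- Z(0) = I − Σ_p (m_p e − n_{·p}) n_{·p}ᵀ / α_p is the identity corrected by rank-one matrices, and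
-- α_p is both bᵀ(m_p e − n_{·p}) and n_{·p}ᵀ(n e − b). Hence bᵀZ(0) = bᵀ − Σ_p n_{·p}ᵀ and
-- Z(0)(n e − b) = (n e − b) − Σ_p (m_p e − n_{·p}), and both vanish because every vertex lies in
-- exactly one component: Σ_p n_{ip} = n_i and Σ_p m_p = n.

open import Defs
open import Data.Nat as ℕ using (ℕ; zero; suc; _≤_; s≤s)
import Data.Nat.Properties as ℕP
open import Data.Nat.Coprimality using (1-coprimeTo) renaming (sym to coprime-sym)
open import Data.Fin using (Fin; zero; suc; punchIn)
open import Data.Fin.Properties using (punchInᵢ≢i) renaming (_≟_ to _≟ᶠ_)
open import Data.Product using (_×_; ∃; _,_)
import Data.Integer as ℤ
import Data.Integer.Properties as ℤP
open import Data.Rational using (ℚ; 0ℚ; 1ℚ; _+_; _*_; _-_; _/_; mkℚ; ↥_; 1/_; ≢-nonZero)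
import Data.Rational.Properties as ℚP
open import Data.Rational.Properties using () renaming (_≟_ to _≟ℚ_)
open import Data.Rational.Solver using (module +-*-Solver)
open import Algebra.Bundles using (CommutativeRing)
open import Algebra.Properties.Ring ℚP.+-*-ring using ([y-z]x≈yx-zx)
open import Algebra.Properties.Semiring.Sum (CommutativeRing.semiring ℚP.+-*-commutativeRing)
  using (sum; sum-syntax; sum-cong-≗; sum-remove; sum-replicate-zero; ∑-comm; *-distribˡ-sum; *-distribʳ-sum)
open import Function.Base using (_∘_)
open import Function.Definitions using (Surjective)
open import Relation.Nullary using (yes; no; contradiction)
open import Relation.Binary.PropositionalEquality
  using (_≡_; _≢_; refl; sym; trans; cong; cong₂; subst; module ≡-Reasoning)
open ≡-Reasoning
open +-*-Solver using (solve; _:+_; _:-_; _:*_; _:=_)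

ℕ→ℚ≡mkℚ : ∀ m → ℕ→ℚ m ≡ mkℚ (ℤ.+ m) 0 (coprime-sym (1-coprimeTo m))
ℕ→ℚ≡mkℚ m = ℚP.normalize-coprime (coprime-sym (1-coprimeTo m))

ℕ→ℚ-+ : ∀ a b → ℕ→ℚ (a ℕ.+ b) ≡ ℕ→ℚ a + ℕ→ℚ b
ℕ→ℚ-+ a b = trans (cong (_/ 1) numerators) (sym (cong₂ _+_ (ℕ→ℚ≡mkℚ a) (ℕ→ℚ≡mkℚ b)))
  where
  numerators : ℤ.+ (a ℕ.+ b) ≡ ℤ.+ a ℤ.* ℤ.+ 1 ℤ.+ ℤ.+ b ℤ.* ℤ.+ 1
  numerators = trans (ℤP.pos-+ a b) (sym (cong₂ ℤ._+_ (ℤP.*-identityʳ (ℤ.+ a)) (ℤP.*-identityʳ (ℤ.+ b))))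

ℕ→ℚ-* : ∀ a b → ℕ→ℚ (a ℕ.* b) ≡ ℕ→ℚ a * ℕ→ℚ b
ℕ→ℚ-* a b = trans (cong (_/ 1) (ℤP.pos-* a b)) (sym (cong₂ _*_ (ℕ→ℚ≡mkℚ a) (ℕ→ℚ≡mkℚ b)))

ℕ→ℚ-∸ : ∀ {a b} → b ≤ a → ℕ→ℚ (a ℕ.∸ b) ≡ ℕ→ℚ a - ℕ→ℚ b
ℕ→ℚ-∸ {a} {b} b≤a = begin
  ℕ→ℚ (a ℕ.∸ b)                          ≡⟨ x≡x+y-y (ℕ→ℚ (a ℕ.∸ b)) (ℕ→ℚ b) ⟩
  ℕ→ℚ (a ℕ.∸ b) + ℕ→ℚ b - ℕ→ℚ b          ≡⟨ cong (_- ℕ→ℚ b) (sym (ℕ→ℚ-+ (a ℕ.∸ b) b)) ⟩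
  ℕ→ℚ (a ℕ.∸ b ℕ.+ b) - ℕ→ℚ b            ≡⟨ cong (λ x → ℕ→ℚ x - ℕ→ℚ b) (ℕP.m∸n+n≡m b≤a) ⟩
  ℕ→ℚ a - ℕ→ℚ b                          ∎
  where
  x≡x+y-y : ∀ x y → x ≡ x + y - y
  x≡x+y-y = solve 2 (λ x y → x := x :+ y :- y) refl

ℕ→ℚ-injective : ∀ {a b} → ℕ→ℚ a ≡ ℕ→ℚ b → a ≡ b
ℕ→ℚ-injective {a} {b} eq =
  ℤP.+-injective (cong ↥_ (trans (sym (ℕ→ℚ≡mkℚ a)) (trans eq (ℕ→ℚ≡mkℚ b))))

sumℚ≡sum : ∀ m (f : Fin m → ℚ) → sumℚ m f ≡ sum f
sumℚ≡sum zero    f = refl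
sumℚ≡sum (suc m) f = cong (f zero +_) (sumℚ≡sum m (f ∘ suc))

ℕ→ℚ-sumℕ : ∀ m (f : Fin m → ℕ) → ℕ→ℚ (sumℕ m f) ≡ ∑[ k < m ] ℕ→ℚ (f k)
ℕ→ℚ-sumℕ zero    f = refl
ℕ→ℚ-sumℕ (suc m) f =
  trans (ℕ→ℚ-+ (f zero) (sumℕ m (f ∘ suc))) (cong (ℕ→ℚ (f zero) +_) (ℕ→ℚ-sumℕ m (f ∘ suc)))

∑-distrib-- : ∀ {m} (f g : Fin m → ℚ) → ∑[ k < m ] (f k - g k) ≡ ∑[ k < m ] f k - ∑[ k < m ] g k
∑-distrib-- {zero}  f g = refl
∑-distrib-- {suc m} f g = begin
  (f zero - g zero) + ∑[ k < m ] (f (suc k) - g (suc k))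
    ≡⟨ cong ((f zero - g zero) +_) (∑-distrib-- (f ∘ suc) (g ∘ suc)) ⟩
  (f zero - g zero) + (∑[ k < m ] f (suc k) - ∑[ k < m ] g (suc k))
    ≡⟨ interchange (f zero) (g zero) _ _ ⟩
  (f zero + ∑[ k < m ] f (suc k)) - (g zero + ∑[ k < m ] g (suc k)) ∎
  where
  interchange : ∀ a b c d → (a - b) + (c - d) ≡ (a + c) - (b + d)
  interchange = solve 4 (λ a b c d → (a :- b) :+ (c :- d) := (a :+ c) :- (b :+ d)) refl

∑-const-1 : ∀ m → ∑[ k < m ] 1ℚ ≡ ℕ→ℚ m
∑-const-1 zero    = refl
∑-const-1 (suc m) = trans (cong (1ℚ +_) (∑-const-1 m)) (sym (ℕ→ℚ-+ 1 m))

δ-refl : ∀ {s} (i : Fin s) → δ i i ≡ 1ℚ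
δ-refl i with i ≟ᶠ i
... | yes _   = refl
... | no i≢i = contradiction refl i≢i

δ-≢ : ∀ {s} {i j : Fin s} → i ≢ j → δ i j ≡ 0ℚ
δ-≢ {i = i} {j} i≢j with i ≟ᶠ j
... | yes i≡j = contradiction i≡j i≢j
... | no _    = refl

δ-sym : ∀ {s} (i j : Fin s) → δ i j ≡ δ j i
δ-sym i j with i ≟ᶠ j
... | yes refl = sym (δ-refl i)
... | no i≢j   = sym (δ-≢ (i≢j ∘ sym))

∑-δ : ∀ {m} (i : Fin m) (f : Fin m → ℚ) → ∑[ j < m ] (δ i j * f j) ≡ f i
∑-δ {suc m} i f = begin
  ∑[ j < suc m ] (δ i j * f j)                                     ≡⟨ sum-remove {i = i} (λ j → δ i j * f j) ⟩
  δ i i * f i + ∑[ k < m ] (δ i (punchIn i k) * f (punchIn i k))  ≡⟨ cong₂ _+_ diagonal off-diagonal ⟩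
  f i + 0ℚ                                                          ≡⟨ ℚP.+-identityʳ (f i) ⟩
  f i                                                               ∎
  where
  diagonal : δ i i * f i ≡ f i
  diagonal = trans (cong (_* f i) (δ-refl i)) (ℚP.*-identityˡ (f i))
  off-diagonal : ∑[ k < m ] (δ i (punchIn i k) * f (punchIn i k)) ≡ 0ℚ
  off-diagonal = trans (sum-cong-≗ λ k → trans (cong (_* f (punchIn i k)) (δ-≢ (punchInᵢ≢i i k ∘ sym)))
                                               (ℚP.*-zeroˡ (f (punchIn i k))))
                       (sum-replicate-zero m)

/'≡*1/' : ∀ x y → x /' y ≡ x * (1ℚ /' y)
/'≡*1/' x y with y ≟ℚ 0ℚ
... | yes _  = sym (ℚP.*-zeroʳ x)
... | no y≢0 = cong (x *_) (sym (ℚP.*-identityˡ (1/_ y {{≢-nonZero y≢0}})))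

*-1/'-inverse : ∀ {y} → y ≢ 0ℚ → y * (1ℚ /' y) ≡ 1ℚ
*-1/'-inverse {y} y≢0 with y ≟ℚ 0ℚ
... | yes y≡0 = contradiction y≡0 y≢0
... | no y≢0′  = trans (cong (y *_) (ℚP.*-identityˡ (1/_ y {{≢-nonZero y≢0′}})))
                       (ℚP.*-inverseʳ y {{≢-nonZero y≢0′}})

Z : ∀ {s c} → (a b : Fin s → Fin c → ℚ) → (Fin c → ℚ) → Fin s → Fin s → ℚ
Z {c = c} a b α i j = δ i j - ∑[ p < c ] ((a j p * b i p) /' α p)

Z-transpose : ∀ {s c} (a b : Fin s → Fin c → ℚ) α i j → Z a b α i j ≡ Z b a α j i
Z-transpose a b α i j =
  cong₂ _-_ (δ-sym i j) (sum-cong-≗ λ p → cong (_/' α p) (ℚP.*-comm (a j p) (b i p)))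

∑[ax/α]v≡x : ∀ {s} (a v : Fin s → ℚ) {α : ℚ} → α ≢ 0ℚ → ∑[ j < s ] (a j * v j) ≡ α →
             ∀ x → ∑[ j < s ] ((a j * x) /' α * v j) ≡ x
∑[ax/α]v≡x {s} a v {α} α≢0 ∑av≡α x = begin
  ∑[ j < s ] ((a j * x) /' α * v j)         ≡⟨ sum-cong-≗ (λ j → cong (_* v j) (/'≡*1/' (a j * x) α)) ⟩
  ∑[ j < s ] (a j * x * (1ℚ /' α) * v j)    ≡⟨ sum-cong-≗ (λ j → regroup (a j) x (1ℚ /' α) (v j)) ⟩
  ∑[ j < s ] (x * (1ℚ /' α) * (a j * v j))  ≡⟨ *-distribˡ-sum (x * (1ℚ /' α)) (λ j → a j * v j) ⟨
  x * (1ℚ /' α) * ∑[ j < s ] (a j * v j)    ≡⟨ cong (x * (1ℚ /' α) *_) ∑av≡α ⟩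
  x * (1ℚ /' α) * α                         ≡⟨ ℚP.*-assoc x (1ℚ /' α) α ⟩
  x * ((1ℚ /' α) * α)                       ≡⟨ cong (x *_) (trans (ℚP.*-comm (1ℚ /' α) α) (*-1/'-inverse α≢0)) ⟩
  x * 1ℚ                                    ≡⟨ ℚP.*-identityʳ x ⟩
  x                                         ∎
  where
  regroup : ∀ y x r z → y * x * r * z ≡ x * r * (y * z)
  regroup = solve 4 (λ y x r z → y :* x :* r :* z := x :* r :* (y :* z)) refl

Z·v≡v-∑b : ∀ {s c} (a b : Fin s → Fin c → ℚ) {α : Fin c → ℚ} → (∀ p → α p ≢ 0ℚ) →
           (v : Fin s → ℚ) → (∀ p → ∑[ j < s ] (a j p * v j) ≡ α p) →
           ∀ i → ∑[ j < s ] (Z a b α i j * v j) ≡ v i - ∑[ p < c ] b i p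
Z·v≡v-∑b {s} {c} a b {α} α≢0 v ∑av≡α i = begin
  ∑[ j < s ] (Z a b α i j * v j)
    ≡⟨ sum-cong-≗ (λ j → [y-z]x≈yx-zx (v j) (δ i j) (∑[ p < c ] t j p)) ⟩
  ∑[ j < s ] (δ i j * v j - (∑[ p < c ] t j p) * v j)
    ≡⟨ ∑-distrib-- (λ j → δ i j * v j) (λ j → (∑[ p < c ] t j p) * v j) ⟩
  ∑[ j < s ] (δ i j * v j) - ∑[ j < s ] ((∑[ p < c ] t j p) * v j)
    ≡⟨ cong₂ _-_ (∑-δ i v) correction ⟩
  v i - ∑[ p < c ] b i p
    ∎
  where
  t : Fin s → Fin c → ℚ
  t j p = (a j p * b i p) /' α p

  correction : ∑[ j < s ] ((∑[ p < c ] t j p) * v j) ≡ ∑[ p < c ] b i p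
  correction = begin
    ∑[ j < s ] ((∑[ p < c ] t j p) * v j)  ≡⟨ sum-cong-≗ (λ j → *-distribʳ-sum (v j) (t j)) ⟩
    ∑[ j < s ] ∑[ p < c ] (t j p * v j)    ≡⟨ ∑-comm (λ j p → t j p * v j) ⟩
    ∑[ p < c ] ∑[ j < s ] (t j p * v j)    ≡⟨ sum-cong-≗ (λ p → ∑[ax/α]v≡x (λ j → a j p) v (α≢0 p) (∑av≡α p) (b i p)) ⟩
    ∑[ p < c ] b i p                       ∎

uᵀZ≡u-∑a : ∀ {s c} (a b : Fin s → Fin c → ℚ) {α : Fin c → ℚ} → (∀ p → α p ≢ 0ℚ) →
           (u : Fin s → ℚ) → (∀ p → ∑[ i < s ] (b i p * u i) ≡ α p) →
           ∀ j → ∑[ i < s ] (u i * Z a b α i j) ≡ u j - ∑[ p < c ] a j p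
uᵀZ≡u-∑a a b {α} α≢0 u ∑bu≡α j =
  trans (sum-cong-≗ λ i → trans (ℚP.*-comm (u i) (Z a b α i j)) (cong (_* u i) (Z-transpose a b α i j)))
        (Z·v≡v-∑b b a α≢0 u ∑bu≡α j)

sumℕ-cong : ∀ m {f g : Fin m → ℕ} → (∀ k → f k ≡ g k) → sumℕ m f ≡ sumℕ m g
sumℕ-cong zero    f≗g = refl
sumℕ-cong (suc m) f≗g = cong₂ ℕ._+_ (f≗g zero) (sumℕ-cong m (f≗g ∘ suc))

term≤sumℕ : ∀ m (f : Fin m → ℕ) k → f k ≤ sumℕ m f
term≤sumℕ (suc m) f zero    = ℕP.m≤m+n (f zero) (sumℕ m (f ∘ suc))
term≤sumℕ (suc m) f (suc k) = ℕP.≤-trans (term≤sumℕ m (f ∘ suc) k) (ℕP.m≤n+m _ (f zero))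

term+term≤sumℕ : ∀ m (f : Fin m → ℕ) {i j} → i ≢ j → f i ℕ.+ f j ≤ sumℕ m f
term+term≤sumℕ (suc m) f {zero}  {zero}  0≢0 = contradiction refl 0≢0
term+term≤sumℕ (suc m) f {zero}  {suc j} _   = ℕP.+-monoʳ-≤ (f zero) (term≤sumℕ m (f ∘ suc) j)
term+term≤sumℕ (suc m) f {suc i} {zero}  _   =
  ℕP.≤-trans (ℕP.≤-reflexive (ℕP.+-comm (f (suc i)) (f zero))) (ℕP.+-monoʳ-≤ (f zero) (term≤sumℕ m (f ∘ suc) i))
term+term≤sumℕ (suc m) f {suc i} {suc j} i≢j =
  ℕP.≤-trans (term+term≤sumℕ m (f ∘ suc) (i≢j ∘ cong suc)) (ℕP.m≤n+m _ (f zero))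

∃-≢ : ∀ {s} → 2 ≤ s → (i : Fin s) → ∃ (_≢ i)
∃-≢ (s≤s (s≤s _)) i = punchIn i zero , punchInᵢ≢i i zero

𝟙[_≡_] : ∀ {c} → Fin c → Fin c → ℕ
𝟙[ q ≡ p ] with q ≟ᶠ p
... | yes _ = 1
... | no _  = 0

𝟙-refl : ∀ {c} (q : Fin c) → 𝟙[ q ≡ q ] ≡ 1
𝟙-refl q with q ≟ᶠ q
... | yes _   = refl
... | no q≢q = contradiction refl q≢q

ℕ→ℚ-𝟙 : ∀ {c} (q p : Fin c) → ℕ→ℚ 𝟙[ q ≡ p ] ≡ δ q p
ℕ→ℚ-𝟙 q p with q ≟ᶠ p
... | yes _ = refl
... | no _  = refl

module ComponentCounts {s : ℕ} (n : Fin s → ℕ) {c : ℕ} (comp : Vtx s n → Fin c) where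

  N : Fin s → ℚ
  N i = ℕ→ℚ (n i)

  T : ℚ
  T = ℕ→ℚ (ntot n)

  A : Fin s → Fin c → ℚ
  A i p = ℕ→ℚ (nip n comp i p)

  M : Fin c → ℚ
  M p = ℕ→ℚ (mp n comp p)

  B : Fin s → Fin c → ℚ
  B i p = M p - A i p

  nip≡∑𝟙 : ∀ i p → nip n comp i p ≡ sumℕ (n i) (λ k → 𝟙[ comp (i , k) ≡ p ])
  nip≡∑𝟙 i p = trans unfold (sumℕ-cong (n i) summand≡𝟙)
    where
    -- Defs counts with a where-local indicator, which can only be named through unification.
    summand : Fin (n i) → ℕ
    summand = _
    unfold : nip n comp i p ≡ sumℕ (n i) summand
    unfold = refl
    summand≡𝟙 : ∀ k → summand k ≡ 𝟙[ comp (i , k) ≡ p ]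
    summand≡𝟙 k with comp (i , k) ≟ᶠ p
    ... | yes _ = refl
    ... | no _  = refl

  ∑A≡N : ∀ i → ∑[ p < c ] A i p ≡ N i
  ∑A≡N i = begin
    ∑[ p < c ] A i p                               ≡⟨ sum-cong-≗ A≡∑δ ⟩
    ∑[ p < c ] ∑[ k < n i ] δ (comp (i , k)) p     ≡⟨ ∑-comm (λ p k → δ (comp (i , k)) p) ⟩
    ∑[ k < n i ] ∑[ p < c ] δ (comp (i , k)) p     ≡⟨ sum-cong-≗ (λ k → ∑δ≡1 (comp (i , k))) ⟩
    ∑[ k < n i ] 1ℚ                                ≡⟨ ∑-const-1 (n i) ⟩
    N i                                            ∎
    where
    A≡∑δ : ∀ p → A i p ≡ ∑[ k < n i ] δ (comp (i , k)) p
    A≡∑δ p = trans (cong ℕ→ℚ (nip≡∑𝟙 i p))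
                   (trans (ℕ→ℚ-sumℕ (n i) _) (sum-cong-≗ λ k → ℕ→ℚ-𝟙 (comp (i , k)) p))
    ∑δ≡1 : ∀ q → ∑[ p < c ] δ q p ≡ 1ℚ
    ∑δ≡1 q = trans (sum-cong-≗ λ p → sym (ℚP.*-identityʳ (δ q p))) (∑-δ q (λ _ → 1ℚ))

  M≡∑A : ∀ p → M p ≡ ∑[ i < s ] A i p
  M≡∑A p = ℕ→ℚ-sumℕ s (λ i → nip n comp i p)

  T≡∑N : T ≡ ∑[ i < s ] N i
  T≡∑N = ℕ→ℚ-sumℕ s n

  ∑M≡T : ∑[ p < c ] M p ≡ T
  ∑M≡T = begin
    ∑[ p < c ] M p               ≡⟨ sum-cong-≗ M≡∑A ⟩
    ∑[ p < c ] ∑[ i < s ] A i p  ≡⟨ ∑-comm (λ p i → A i p) ⟩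
    ∑[ i < s ] ∑[ p < c ] A i p  ≡⟨ sum-cong-≗ ∑A≡N ⟩
    ∑[ i < s ] N i               ≡⟨ T≡∑N ⟨
    T                            ∎

  α≡TM-∑NA : ∀ p → α n comp p ≡ T * M p - ∑[ i < s ] (N i * A i p)
  α≡TM-∑NA p = cong (T * M p -_) (sumℚ≡sum s (λ i → N i * A i p))

  α≡∑[M-A]N : ∀ p → α n comp p ≡ ∑[ i < s ] ((M p - A i p) * N i)
  α≡∑[M-A]N p = begin
    α n comp p                                          ≡⟨ α≡TM-∑NA p ⟩
    T * M p - ∑[ i < s ] (N i * A i p)                  ≡⟨ cong (λ x → x * M p - ∑[ i < s ] (N i * A i p)) T≡∑N ⟩
    (∑[ i < s ] N i) * M p - ∑[ i < s ] (N i * A i p)   ≡⟨ cong (_- ∑[ i < s ] (N i * A i p)) (*-distribʳ-sum (M p) N) ⟩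
    ∑[ i < s ] (N i * M p) - ∑[ i < s ] (N i * A i p)   ≡⟨ ∑-distrib-- (λ i → N i * M p) (λ i → N i * A i p) ⟨
    ∑[ i < s ] (N i * M p - N i * A i p)                ≡⟨ sum-cong-≗ (λ i → factor (N i) (M p) (A i p)) ⟩
    ∑[ i < s ] ((M p - A i p) * N i)                    ∎
    where
    factor : ∀ x y z → x * y - x * z ≡ (y - z) * x
    factor = solve 3 (λ x y z → x :* y :- x :* z := (y :- z) :* x) refl

  α≡∑A[T-N] : ∀ p → α n comp p ≡ ∑[ j < s ] (A j p * (T - N j))
  α≡∑A[T-N] p = begin
    α n comp p                                          ≡⟨ α≡TM-∑NA p ⟩
    T * M p - ∑[ j < s ] (N j * A j p)                  ≡⟨ cong (λ x → T * x - ∑[ j < s ] (N j * A j p)) (M≡∑A p) ⟩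
    T * ∑[ j < s ] A j p - ∑[ j < s ] (N j * A j p)     ≡⟨ cong (_- ∑[ j < s ] (N j * A j p)) (*-distribˡ-sum T (λ j → A j p)) ⟩
    ∑[ j < s ] (T * A j p) - ∑[ j < s ] (N j * A j p)   ≡⟨ ∑-distrib-- (λ j → T * A j p) (λ j → N j * A j p) ⟨
    ∑[ j < s ] (T * A j p - N j * A j p)                ≡⟨ sum-cong-≗ (λ j → factor T (N j) (A j p)) ⟩
    ∑[ j < s ] (A j p * (T - N j))                      ∎
    where
    factor : ∀ x y z → x * z - y * z ≡ z * (x - y)
    factor = solve 3 (λ x y z → x :* z :- y :* z := z :* (x :- y)) refl

  αℕ : Fin c → ℕ
  αℕ p = sumℕ s (λ i → (mp n comp p ℕ.∸ nip n comp i p) ℕ.* n i)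

  α≡αℕ : ∀ p → α n comp p ≡ ℕ→ℚ (αℕ p)
  α≡αℕ p = trans (α≡∑[M-A]N p) (trans (sum-cong-≗ term) (sym (ℕ→ℚ-sumℕ s _)))
    where
    term : ∀ i → (M p - A i p) * N i ≡ ℕ→ℚ ((mp n comp p ℕ.∸ nip n comp i p) ℕ.* n i)
    term i = sym (trans (ℕ→ℚ-* (mp n comp p ℕ.∸ nip n comp i p) (n i))
                        (cong (_* N i) (ℕ→ℚ-∸ (term≤sumℕ s (λ i → nip n comp i p) i))))

  nip≥1 : ∀ {i k p} → comp (i , k) ≡ p → 1 ≤ nip n comp i p
  nip≥1 {i} {k} refl rewrite nip≡∑𝟙 i (comp (i , k)) =
    subst (_≤ sumℕ (n i) hits) (𝟙-refl (comp (i , k))) (term≤sumℕ (n i) hits k)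
    where
    hits : Fin (n i) → ℕ
    hits k′ = 𝟙[ comp (i , k′) ≡ comp (i , k) ]

  αℕ≥1 : 2 ≤ s → (∀ i → 1 ≤ n i) → Surjective _≡_ _≡_ comp → ∀ p → 1 ≤ αℕ p
  αℕ≥1 2≤s n≥1 surj p with surj p
  ... | (i , k) , comp≡p with ∃-≢ 2≤s i
  ... | j , j≢i = ℕP.≤-trans (ℕP.*-mono-≤ (ℕP.m<n⇒0<n∸m nip<mp) (n≥1 j)) (term≤sumℕ s _ j)
    where
    nip<mp : nip n comp j p ℕ.< mp n comp p
    nip<mp = ℕP.≤-trans (ℕP.≤-reflexive (ℕP.+-comm 1 (nip n comp j p)))
                        (ℕP.≤-trans (ℕP.+-monoʳ-≤ (nip n comp j p) (nip≥1 (comp≡p refl)))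
                                    (term+term≤sumℕ s (λ i → nip n comp i p) j≢i))

  nonempty⇒α≢0 : 2 ≤ s → (∀ i → 1 ≤ n i) → Surjective _≡_ _≡_ comp → ∀ p → α n comp p ≢ 0ℚ
  nonempty⇒α≢0 2≤s n≥1 surj p α≡0 =
    ℕP.<⇒≢ (αℕ≥1 2≤s n≥1 surj p) (sym (ℕ→ℚ-injective (trans (sym (α≡αℕ p)) α≡0)))

  Z0≡Z : ∀ i j → Z0 n comp i j ≡ Z A B (α n comp) i j
  Z0≡Z i j = cong (δ i j -_) (sumℚ≡sum c (λ p → (A j p * B i p) /' α n comp p))

  module _ (α≢0 : ∀ p → α n comp p ≢ 0ℚ) where

    bᵀZ0≡0 : ∀ j → sumℚ s (λ i → N i * Z0 n comp i j) ≡ 0ℚ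
    bᵀZ0≡0 j = begin
      sumℚ s (λ i → N i * Z0 n comp i j)       ≡⟨ sumℚ≡sum s (λ i → N i * Z0 n comp i j) ⟩
      ∑[ i < s ] (N i * Z0 n comp i j)         ≡⟨ sum-cong-≗ (λ i → cong (N i *_) (Z0≡Z i j)) ⟩
      ∑[ i < s ] (N i * Z A B (α n comp) i j)  ≡⟨ uᵀZ≡u-∑a A B α≢0 N (sym ∘ α≡∑[M-A]N) j ⟩
      N j - ∑[ p < c ] A j p                   ≡⟨ cong (N j -_) (∑A≡N j) ⟩
      N j - N j                                ≡⟨ ℚP.+-inverseʳ (N j) ⟩
      0ℚ                                       ∎

    Z0[ne-b]≡0 : ∀ i → sumℚ s (λ j → Z0 n comp i j * (T - N j)) ≡ 0ℚ
    Z0[ne-b]≡0 i = begin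
      sumℚ s (λ j → Z0 n comp i j * (T - N j))       ≡⟨ sumℚ≡sum s (λ j → Z0 n comp i j * (T - N j)) ⟩
      ∑[ j < s ] (Z0 n comp i j * (T - N j))         ≡⟨ sum-cong-≗ (λ j → cong (_* (T - N j)) (Z0≡Z i j)) ⟩
      ∑[ j < s ] (Z A B (α n comp) i j * (T - N j))  ≡⟨ Z·v≡v-∑b A B α≢0 (λ j → T - N j) (sym ∘ α≡∑A[T-N]) i ⟩
      (T - N i) - ∑[ p < c ] B i p                   ≡⟨ cong ((T - N i) -_) ∑B≡T-N ⟩
      (T - N i) - (T - N i)                          ≡⟨ ℚP.+-inverseʳ (T - N i) ⟩
      0ℚ                                             ∎
      where
      ∑B≡T-N : ∑[ p < c ] B i p ≡ T - N i
      ∑B≡T-N = trans (∑-distrib-- M (A i)) (cong₂ _-_ ∑M≡T (∑A≡N i))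

lemma4p2 : (s : ℕ) → 2 ≤ s → (n : Fin s → ℕ) → (∀ i → 1 ≤ n i) →
           (F : SpanningForestOfK s n) → (c : ℕ) → (comp : Vtx s n → Fin c) →
           Components F c comp →
           (∀ j → sumℚ s (λ i → ℕ→ℚ (n i) * Z0 n comp i j) ≡ 0ℚ)
           × (∀ i → sumℚ s (λ j → Z0 n comp i j * (ℕ→ℚ (ntot n) - ℕ→ℚ (n j))) ≡ 0ℚ)
lemma4p2 s 2≤s n n≥1 F c comp components = bᵀZ0≡0 α≢0 , Z0[ne-b]≡0 α≢0
  where
  open ComponentCounts n comp
  α≢0 : ∀ p → α n comp p ≢ 0ℚ
  α≢0 = nonempty⇒α≢0 2≤s n≥1 (Components.surj components)
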